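{- Let $L=K(x_0,\dots,x_n)/K$ be a near one-dimensional elementary abelian extension with data as in the context, and let $X_j^{(i)}$, $B_i$, $E_j^{(i)}$ be defined as in the context. Then for $0\le i\le j\le n$, $$\wp(X_j^{(i)})=\phi^{n-i}(\Omega_j^{(i)})B_i+E_j^{(i)}.$$
   Context: $p$ prime, $\mathbb{F}$ a finite field of characteristic $p$ or $\overline{\mathbb{F}}_p$, $K=\mathbb{F}((t))$, $v_K$ normalized valuation, $\mathfrak O_K,\mathfrak P_K$, $\wp(x)=x^p-x$, $\phi(x)=x^p$. Near one-dimensional elementary abelian extension: a fully ramified Galois extension $L/K$ of degree $p^{n+1}$ with $L=K(x_0,\dots,x_n)$, $x_i^p-x_i=\phi^n(\Omega_i)\beta+\epsilon_i$, where $\beta\in K$, $v_K(\beta)=-b$, $b>0$, $\gcd(b,p)=1$; $\Omega_0,\dots,\Omega_n\in K$ linearly independent over $\mathbb{F}_p$, $\Omega_0=1$, $v_K(\Omega_n)\le\cdots\le v_K(\Omega_0)=0$; whenever $v_K(\Omega_i)=\cdots=v_K(\Omega_j)$, $i<j$, the images of $\phi^n(\Omega_i)\beta,\dots,\phi^n(\Omega_j)\beta$ in $\phi^n(\Omega_i)\beta\mathfrak O_K/\phi^n(\Omega_i)\beta\mathfrak P_K$ are $\mathbb{F}_p$-independent; $\epsilon_0=0$ and with $m_j=v_K(\Omega_{j-1})-v_K(\Omega_j)$, $v_K(\epsilon_i)>-\frac{b}{p^n}-\sum_{j=1}^{i}p^jm_j+\sum_{j=i+1}^{n}(p^n-p^j)m_j$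 for $1\le i\le n$. Define $\Omega_j^{(0)}=\Omega_j$, $\Omega_j^{(i)}=\wp(\Omega_j^{(i-1)})/\wp(\Omega_i^{(i-1)})$ for $1\le i\le j\le n$. Define $X_j^{(0)}=x_j$ and for $1\le i\le j$, $X_j^{(i)}=X_j^{(i-1)}-\phi^{n-i}(\Omega_j^{(i-1)})X_{i-1}^{(i-1)}$. Define $B_0=\beta$, $E_j^{(0)}=\epsilon_j$ (so $E_0^{(0)}=0$), and for $i\ge1$: $B_i=-\phi^{n-i}(\wp(\Omega_i^{(i-1)}))X_{i-1}^{(i-1)}+E_i^{(i-1)}$, $E_j^{(i)}=E_j^{(i-1)}-\phi^{n-i}(\Omega_j^{(i)})E_i^{(i-1)}$ for $j>i$, and $E_i^{(i)}=0$. -}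

module Defs where

open import Level using (Level; _⊔_) renaming (suc to lsuc)
open import Data.Nat as ℕ using (ℕ; zero; suc; _∸_; _<_; _≤_; _≟_)
open import Data.Nat.Primality using (Prime)
open import Relation.Nullary using (¬_; yes; no)
open import Relation.Binary.PropositionalEquality using (_≡_)
open import Algebra.Bundles using (CommutativeRing; RawRing)
open import Algebra.Morphism.Structures using (module RingMorphisms)

record Field (c ℓ : Level) : Set (lsuc (c ⊔ ℓ)) where
  field
    commutativeRing : CommutativeRing c ℓ
  open CommutativeRing commutativeRing public
  field
    _⁻¹       : Carrier → Carrier
    ⁻¹-inverse : ∀ x → ¬ (x ≈ 0#) → (x * (x ⁻¹)) ≈ 1#
    0≉1       : ¬ (0# ≈ 1#)

module FieldOps {c ℓ} (F : Field c ℓ) (p : ℕ) where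
  open Field F

  _·_ : ℕ → Carrier → Carrier
  zero  · a = 0#
  suc k · a = a + (k · a)

  pow : Carrier → ℕ → Carrier
  pow a zero    = 1#
  pow a (suc k) = a * pow a k

  φ : Carrier → Carrier
  φ a = pow a p

  φ^ : ℕ → Carrier → Carrier
  φ^ zero    a = a
  φ^ (suc k) a = φ (φ^ k a)

  ℘ : Carrier → Carrier
  ℘ a = φ a - a

  Σ≤ : ℕ → (ℕ → Carrier) → Carrier
  Σ≤ zero    f = f 0
  Σ≤ (suc n) f = Σ≤ n f + f (suc n)

  HasCharacteristic : Set ℓ
  HasCharacteristic = (p · 1#) ≈ 0#

  LinIndepFp : ℕ → (ℕ → Carrier) → Set ℓ
  LinIndepFp n Ω = (cf : ℕ → ℕ) → (∀ i → i ≤ n → cf i < p) →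
                   Σ≤ n (λ i → cf i · Ω i) ≈ 0# → ∀ i → i ≤ n → cf i ≡ 0

IsFieldHom : ∀ {c ℓ c' ℓ'} (K : Field c ℓ) (L : Field c' ℓ') →
             (Field.Carrier K → Field.Carrier L) → Set (c ⊔ ℓ ⊔ ℓ')
IsFieldHom K L ι = RingMorphisms.IsRingHomomorphism
  (CommutativeRing.rawRing (Field.commutativeRing K))
  (CommutativeRing.rawRing (Field.commutativeRing L)) ι

-- The recursively defined quantities Ω_j^{(i)}, X_j^{(i)}, E_j^{(i)}, B_i of
-- the context.  Indices are natural numbers; only 0 ≤ i ≤ j ≤ n are used.
module Construction {c ℓ c' ℓ'} (K : Field c ℓ) (L : Field c' ℓ')
  (ι : Field.Carrier K → Field.Carrier L) (p n : ℕ)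
  (x : ℕ → Field.Carrier L) (Ω : ℕ → Field.Carrier K)
  (β : Field.Carrier K) (ε : ℕ → Field.Carrier K) where

  private
    module K = Field K
    module L = Field L
    module OK = FieldOps K p
    module OL = FieldOps L p

  Ωs : ℕ → ℕ → K.Carrier
  Ωs zero    j = Ω j
  Ωs (suc i) j = OK.℘ (Ωs i j) K.* (OK.℘ (Ωs i (suc i)) K.⁻¹)

  X : ℕ → ℕ → L.Carrier
  X zero    j = x j
  X (suc i) j = X i j L.- (ι (OK.φ^ (n ∸ suc i) (Ωs i j)) L.* X i i)

  E : ℕ → ℕ → K.Carrier
  E zero    j = ε j
  E (suc i) j with j ≟ suc i
  ... | yes _ = K.0#
  ... | no  _ = E i j K.- (OK.φ^ (n ∸ suc i) (Ωs (suc i) j) K.* E i (suc i))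

  B : ℕ → L.Carrier
  B zero    = ι β
  B (suc i) = (L.- (ι (OK.φ^ (n ∸ suc i) (OK.℘ (Ωs i (suc i)))) L.* X i i))
              L.+ ι (E i (suc i))

{-# OPTIONS --safe #-}
module Submission where

-- Since X_j^(i+1) = X_j^(i) − a X_i^(i) with a = φ^(n−i−1)(Ω_j^(i)) ∈ K, and in
-- characteristic p the map ℘ is additive with ℘(a Y) = φ(a) ℘(Y) + ℘(a) Y, the step reduces to the
-- recursions defining Ω, B and E, provided ℘(X_i^(i)) = B_i, i.e. Ω_i^(i) = 1 and ℘(Ω_(i+1)^(i)) ≠ 0.
-- Both follow from the invariant that Ω_i^(i) = 1 and Ω_i^(i), …, Ω_n^(i) are 𝔽ₚ-independent:
-- ℘ is additive with kernel 𝔽ₚ, so a relation Σ c_k ℘(Ω_k^(i)) = 0 gives Σ c_k Ω_k^(i) ∈ 𝔽ₚ = 𝔽ₚ Ω_i^(i),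
-- which independence forces to be trivial.

open import Defs
open import Algebra.Bundles using (CommutativeRing; CommutativeSemiring; Monoid)
open import Algebra.Morphism.Structures using (module RingMorphisms)
open import Algebra.Solver.Ring.AlmostCommutativeRing using (fromCommutativeRing; _-Raw-AlmostCommutative⟶_)
import Algebra.Properties.CommutativeSemigroup
open import Data.Nat as ℕ using (ℕ; zero; suc; _<_; _≤_; z≤n; s≤s; _∸_; _!)
import Data.Nat.Properties as ℕ
open import Data.Nat.Combinatorics using (_C_; nCk≡n!/k![n-k]!; k![n∸k]!∣n!; nCn≡1)
open import Data.Nat.Coprimality using (prime⇒coprime; coprime-Bézout)
open import Data.Nat.Divisibility using (_∣_; divides; ∣⇒≤; ∣1⇒≡1; m∣m*n)
open import Data.Nat.DivMod using (m/n*n≡m)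
open import Data.Nat.GCD using (module Bézout)
open import Data.Nat.Primality using (Prime; euclidsLemma; ¬prime[1])
open import Data.Integer as ℤ using (ℤ; _⊖_; _◃_; sign; ∣_∣)
import Data.Integer.Properties as ℤ
open import Data.Sign as Sign using (Sign)
open import Data.Fin as Fin using (toℕ; fromℕ; inject₁)
import Data.Fin.Properties as Fin
open import Data.Vec using (Vec; []; _∷_; last)
open import Data.Vec.Functional using (Vector)
open import Data.Maybe using (Maybe; just; nothing)
open import Data.Product using (_,_; proj₁; proj₂)
open import Data.Sum using (inj₁; inj₂)
open import Data.Empty using (⊥-elim)
open import Relation.Nullary using (¬_; yes; no)
open import Relation.Binary.PropositionalEquality as ≡ using (_≡_; _≢_)

-- Algebra.Solver.Ring needs a coefficient ring with decidable equality; for an arbitrary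
-- commutative ring R this is ℤ, acting through its canonical homomorphism into R.
module IntegerCoefficients {c ℓ} (R : CommutativeRing c ℓ) where
  open CommutativeRing R
  open import Algebra.Properties.Ring ring using (-‿involutive; -‿distribˡ-*; -‿distribʳ-*; -0#≈0#; -‿+-comm)
  open import Algebra.Properties.Semiring.Mult semiring using (_×_; ×-homo-+; ×1-homo-*)
  open import Relation.Binary.Reasoning.Setoid setoid
  private module + = Algebra.Properties.CommutativeSemigroup +-commutativeSemigroup

  signed : Sign → Carrier → Carrier
  signed Sign.+ x = x
  signed Sign.- x = - x

  fromℤ : ℤ → Carrier
  fromℤ i = signed (sign i) (∣ i ∣ × 1#)

  signed-cong : ∀ s {x y} → x ≈ y → signed s x ≈ signed s y
  signed-cong Sign.+ x≈y = x≈y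
  signed-cong Sign.- x≈y = -‿cong x≈y

  signed-* : ∀ s t x y → signed (s Sign.* t) (x * y) ≈ signed s x * signed t y
  signed-* Sign.+ Sign.+ x y = refl
  signed-* Sign.+ Sign.- x y = -‿distribʳ-* x y
  signed-* Sign.- Sign.+ x y = -‿distribˡ-* x y
  signed-* Sign.- Sign.- x y = begin
    x * y          ≈⟨ -‿involutive _ ⟨
    - - (x * y)    ≈⟨ -‿cong (-‿distribʳ-* x y) ⟩
    - (x * - y)    ≈⟨ -‿distribˡ-* x (- y) ⟩
    - x * - y      ∎

  fromℤ-◃ : ∀ s n → fromℤ (s ◃ n) ≈ signed s (n × 1#)
  fromℤ-◃ Sign.+ zero    = refl
  fromℤ-◃ Sign.- zero    = sym -0#≈0#
  fromℤ-◃ Sign.+ (suc n) = refl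
  fromℤ-◃ Sign.- (suc n) = refl

  fromℤ-* : ∀ i j → fromℤ (i ℤ.* j) ≈ fromℤ i * fromℤ j
  fromℤ-* i j = begin
    fromℤ (s ◃ ∣ i ∣ ℕ.* ∣ j ∣)                ≈⟨ fromℤ-◃ s (∣ i ∣ ℕ.* ∣ j ∣) ⟩
    signed s ((∣ i ∣ ℕ.* ∣ j ∣) × 1#)          ≈⟨ signed-cong s (×1-homo-* ∣ i ∣ ∣ j ∣) ⟩
    signed s ((∣ i ∣ × 1#) * (∣ j ∣ × 1#))     ≈⟨ signed-* (sign i) (sign j) _ _ ⟩
    fromℤ i * fromℤ j                         ∎
    where s = sign i Sign.* sign j

  fromℤ-neg : ∀ i → fromℤ (ℤ.- i) ≈ - fromℤ i
  fromℤ-neg ℤ.-[1+ n ]  = sym (-‿involutive _)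
  fromℤ-neg (ℤ.+ zero)  = sym -0#≈0#
  fromℤ-neg (ℤ.+ suc n) = refl

  fromℤ-⊖ : ∀ m n → fromℤ (m ⊖ n) ≈ m × 1# - n × 1#
  fromℤ-⊖ zero    zero    = sym (-‿inverseʳ 0#)
  fromℤ-⊖ zero    (suc n) = sym (+-identityˡ _)
  fromℤ-⊖ (suc m) zero    = sym (trans (+-congˡ -0#≈0#) (+-identityʳ _))
  fromℤ-⊖ (suc m) (suc n) = begin
    fromℤ (suc m ⊖ suc n)                ≡⟨ ≡.cong fromℤ (ℤ.[1+m]⊖[1+n]≡m⊖n m n) ⟩
    fromℤ (m ⊖ n)                        ≈⟨ fromℤ-⊖ m n ⟩
    m × 1# - n × 1#                      ≈⟨ +-identityˡ _ ⟨
    0# + (m × 1# - n × 1#)               ≈⟨ +-congʳ (-‿inverseʳ 1#) ⟨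
    (1# - 1#) + (m × 1# - n × 1#)        ≈⟨ +.interchange _ _ _ _ ⟩
    (1# + m × 1#) + (- 1# - n × 1#)      ≈⟨ +-congˡ (-‿+-comm 1# _) ⟩
    (1# + m × 1#) - (1# + n × 1#)        ∎

  fromℤ-+ : ∀ i j → fromℤ (i ℤ.+ j) ≈ fromℤ i + fromℤ j
  fromℤ-+ ℤ.-[1+ m ] ℤ.-[1+ n ] = begin
    - (suc (suc (m ℕ.+ n)) × 1#)         ≈⟨ -‿cong (+-congˡ (×-homo-+ 1# (suc m) n)) ⟩
    - (1# + ((suc m × 1#) + n × 1#))     ≈⟨ -‿cong (+.x∙yz≈y∙xz _ _ _) ⟩
    - ((suc m × 1#) + (1# + n × 1#))     ≈⟨ -‿+-comm _ _ ⟨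
    fromℤ ℤ.-[1+ m ] + fromℤ ℤ.-[1+ n ] ∎
  fromℤ-+ ℤ.-[1+ m ] (ℤ.+ n)    = trans (fromℤ-⊖ n (suc m)) (+-comm _ _)
  fromℤ-+ (ℤ.+ m)    ℤ.-[1+ n ] = fromℤ-⊖ m (suc n)
  fromℤ-+ (ℤ.+ m)    (ℤ.+ n)    = ×-homo-+ 1# m n

  fromℤ-homomorphism : CommutativeRing.rawRing ℤ.+-*-commutativeRing -Raw-AlmostCommutative⟶ fromCommutativeRing R
  fromℤ-homomorphism = record
    { ⟦_⟧ = fromℤ ; +-homo = fromℤ-+ ; *-homo = fromℤ-* ; -‿homo = fromℤ-neg
    ; 0-homo = refl ; 1-homo = +-identityʳ 1# }

  fromℤ-≟ : ∀ i j → Maybe (fromℤ i ≈ fromℤ j)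
  fromℤ-≟ i j with i ℤ.≟ j
  ... | yes ≡.refl = just refl
  ... | no  _      = nothing

  open import Algebra.Solver.Ring (CommutativeRing.rawRing ℤ.+-*-commutativeRing) (fromCommutativeRing R)
                                  fromℤ-homomorphism fromℤ-≟ public
    using (solve; _:=_; _:+_; _:*_; _:-_; :-_; con)

prime∤! : ∀ {p j} → Prime p → j < p → ¬ p ∣ j !
prime∤! {j = zero}  pp _   p∣1 = ¬prime[1] (≡.subst Prime (∣1⇒≡1 p∣1) pp)
prime∤! {j = suc j} pp j<p p∣[1+j]! with euclidsLemma (suc j) (j !) pp p∣[1+j]!
... | inj₁ p∣1+j = ℕ.<⇒≱ j<p (∣⇒≤ p∣1+j)
... | inj₂ p∣j!  = prime∤! pp (ℕ.<-trans (ℕ.n<1+n j) j<p) p∣j!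

prime∣pCk : ∀ {p k} → Prime p → 0 < k → k < p → p ∣ p C k
prime∣pCk {suc q} {k} pp 0<k k<p
  with euclidsLemma (suc q C k) (k ! ℕ.* (suc q ∸ k) !) pp
                    (≡.subst (suc q ∣_) (≡.sym pCk*k![p∸k]!≡p!) (m∣m*n (q !)))
  where
  pCk*k![p∸k]!≡p! : (suc q C k) ℕ.* (k ! ℕ.* (suc q ∸ k) !) ≡ suc q !
  pCk*k![p∸k]!≡p! = ≡.trans (≡.cong (ℕ._* (k ! ℕ.* (suc q ∸ k) !)) (nCk≡n!/k![n-k]! (ℕ.<⇒≤ k<p)))
                            (m/n*n≡m {{k ℕ.!* (suc q ∸ k) !≢0}} (k![n∸k]!∣n! (ℕ.<⇒≤ k<p)))
... | inj₁ p∣pCk = p∣pCk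
... | inj₂ p∣k![p∸k]! with euclidsLemma (k !) ((suc q ∸ k) !) pp p∣k![p∸k]!
...   | inj₁ p∣k!     = ⊥-elim (prime∤! pp k<p p∣k!)
...   | inj₂ p∣[p∸k]! = ⊥-elim (prime∤! pp (ℕ.∸-monoʳ-< 0<k (ℕ.<⇒≤ k<p)) p∣[p∸k]!)

module _ {a ℓ} (M : Monoid a ℓ) where
  open Monoid M
  open import Algebra.Properties.Monoid.Sum M using (sum)

  sum-≈-last : ∀ n (g : Vector Carrier (suc n)) → (∀ i → g (inject₁ i) ≈ ε) → sum g ≈ g (fromℕ n)
  sum-≈-last zero    g _     = identityʳ _
  sum-≈-last (suc n) g g≈ε =
    trans (∙-cong (g≈ε Fin.zero) (sum-≈-last n (λ i → g (Fin.suc i)) (λ i → g≈ε (Fin.suc i)))) (identityˡ _)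

module _ {c ℓ} (S : CommutativeSemiring c ℓ) where
  open CommutativeSemiring S
  open import Algebra.Properties.Semiring.Mult semiring using (_×_; ×-assoc-*; ×-congʳ)
  open import Algebra.Properties.Semiring.Exp semiring using (_^_)
  open import Algebra.Properties.CommutativeSemiring.Binomial S using (theorem; binomialTerm)
  open import Relation.Binary.Reasoning.Setoid setoid

  ^-distrib-+-if-binomials-vanish : ∀ n → (∀ k → 0 < k → k < suc n → (suc n C k) × 1# ≈ 0#) →
                                    ∀ x y → (x + y) ^ suc n ≈ x ^ suc n + y ^ suc n
  ^-distrib-+-if-binomials-vanish n vanish x y = begin
    (x + y) ^ p                                                              ≈⟨ theorem p x y ⟩
    binomialTerm x y p Fin.zero + sum (λ i → binomialTerm x y p (Fin.suc i))
      ≈⟨ +-cong (trans (+-identityʳ _) (*-identityˡ _))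
                (sum-≈-last +-monoid n (λ i → binomialTerm x y p (Fin.suc i)) middle≈0) ⟩
    y ^ p + binomialTerm x y p (fromℕ p)                                     ≈⟨ +-congˡ last≈x^p ⟩
    y ^ p + x ^ p                                                            ≈⟨ +-comm _ _ ⟩
    x ^ p + y ^ p                                                            ∎
    where
    p = suc n
    open import Algebra.Properties.Semiring.Sum semiring using (sum)
    last≈x^p : binomialTerm x y p (fromℕ p) ≈ x ^ p
    last≈x^p = begin
      (p C toℕ (fromℕ p)) × (x ^ toℕ (fromℕ p) * y ^ (p ∸ toℕ (fromℕ p)))
        ≡⟨ ≡.cong (λ k → (p C k) × (x ^ k * y ^ (p ∸ k))) (Fin.toℕ-fromℕ p) ⟩
      (p C p) × (x ^ p * y ^ (p ∸ p))   ≡⟨ ≡.cong₂ (λ c e → c × (x ^ p * y ^ e)) (nCn≡1 p) (ℕ.n∸n≡0 p) ⟩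
      x ^ p * 1# + 0#                   ≈⟨ trans (+-identityʳ _) (*-identityʳ _) ⟩
      x ^ p                             ∎
    middle≈0 : ∀ i → binomialTerm x y p (Fin.suc (inject₁ i)) ≈ 0#
    middle≈0 i = begin
      (p C k) × z            ≈⟨ ×-congʳ (p C k) (*-identityˡ z) ⟨
      (p C k) × (1# * z)     ≈⟨ ×-assoc-* (p C k) 1# z ⟨
      ((p C k) × 1#) * z     ≈⟨ *-congʳ (vanish k (s≤s z≤n) (s≤s i<n)) ⟩
      0# * z                 ≈⟨ zeroˡ z ⟩
      0#                     ∎
      where
      k = suc (toℕ (inject₁ i))
      z = x ^ k * y ^ (p ∸ k)
      i<n = ≡.subst (_< n) (≡.sym (Fin.toℕ-inject₁ i)) (Fin.toℕ<n i)

module Polynomial {c ℓ} (F : Field c ℓ) where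
  open Field F
  open IntegerCoefficients commutativeRing
  open import Relation.Binary.Reasoning.Setoid setoid
  open import Algebra.Properties.Semiring.Exp semiring using (_^_)
  open import Algebra.Properties.Ring ring using (x∙y⁻¹≈ε⇒x≈y)

  eval : ∀ {n} → Vec Carrier n → Carrier → Carrier
  eval []       x = 0#
  eval (a ∷ as) x = a + x * eval as x

  monomial : ∀ n → Vec Carrier (suc n)
  monomial zero    = 1# ∷ []
  monomial (suc n) = 0# ∷ monomial n

  eval-monomial : ∀ n x → eval (monomial n) x ≈ x ^ n
  eval-monomial zero    x = trans (+-congˡ (zeroʳ x)) (+-identityʳ 1#)
  eval-monomial (suc n) x = trans (+-identityˡ _) (*-congˡ (eval-monomial n x))

  last-monomial : ∀ n → last (monomial n) ≡ 1#
  last-monomial zero    = ≡.refl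
  last-monomial (suc n) = last-monomial n

  quotient : ∀ {n} → Vec Carrier (suc n) → Carrier → Vec Carrier n
  quotient (a ∷ [])         r = []
  quotient (a ∷ as@(_ ∷ _)) r = eval as r ∷ quotient as r

  factor-theorem : ∀ {n} (P : Vec Carrier (suc n)) r x → eval P x ≈ (x - r) * eval (quotient P r) x + eval P r
  factor-theorem (a ∷ []) r x =
    solve 3 (λ a r x → a :+ x :* 0ᶜ := (x :- r) :* 0ᶜ :+ (a :+ r :* 0ᶜ)) refl a r x
    where 0ᶜ = con (ℤ.+ 0)
  factor-theorem (a ∷ as@(_ ∷ _)) r x = begin
    a + x * eval as x                          ≈⟨ +-congˡ (*-congˡ (factor-theorem as r x)) ⟩
    a + x * ((x - r) * Q + eval as r)
      ≈⟨ solve 5 (λ a x r Q s → a :+ x :* ((x :- r) :* Q :+ s) := (x :- r) :* (s :+ x :* Q) :+ (a :+ r :* s))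
                 refl a x r Q (eval as r) ⟩
    (x - r) * (eval as r + x * Q) + (a + r * eval as r) ∎
    where Q = eval (quotient as r) x

  last-quotient : ∀ {n} (P : Vec Carrier (suc (suc n))) r → last (quotient P r) ≈ last P
  last-quotient (a ∷ b ∷ [])     r = trans (+-congˡ (zeroʳ r)) (+-identityʳ b)
  last-quotient (a ∷ b ∷ c ∷ cs) r = last-quotient (b ∷ c ∷ cs) r

  no-zero-divisors : ∀ {u v} → u * v ≈ 0# → ¬ u ≈ 0# → v ≈ 0#
  no-zero-divisors {u} {v} uv≈0 u≉0 = begin
    v                  ≈⟨ *-identityˡ v ⟨
    1# * v             ≈⟨ *-congʳ (⁻¹-inverse u u≉0) ⟨
    (u * u ⁻¹) * v     ≈⟨ solve 3 (λ u w v → (u :* w) :* v := w :* (u :* v)) refl u (u ⁻¹) v ⟩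
    u ⁻¹ * (u * v)     ≈⟨ *-congˡ uv≈0 ⟩
    u ⁻¹ * 0#          ≈⟨ zeroʳ _ ⟩
    0#                 ∎

  last≈0-of-distinct-roots : ∀ d (P : Vec Carrier (suc d)) (rs : ℕ → Carrier) →
                         (∀ i j → i < j → j ≤ d → ¬ rs i ≈ rs j) → (∀ i → i ≤ d → eval P (rs i) ≈ 0#) →
                         last P ≈ 0#
  last≈0-of-distinct-roots zero (a ∷ []) rs _ roots = trans (sym (trans (+-congˡ (zeroʳ _)) (+-identityʳ a))) (roots 0 z≤n)
  last≈0-of-distinct-roots (suc d) P rs distinct roots = begin
    last P                  ≈⟨ last-quotient P r ⟨
    last (quotient P r)     ≈⟨ last≈0-of-distinct-roots d (quotient P r) rs
                                 (λ i j i<j j≤d → distinct i j i<j (ℕ.m≤n⇒m≤1+n j≤d)) quotient-roots ⟩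
    0#                      ∎
    where
    r = rs (suc d)
    quotient-roots : ∀ i → i ≤ d → eval (quotient P r) (rs i) ≈ 0#
    quotient-roots i i≤d = no-zero-divisors (begin
      (rs i - r) * eval (quotient P r) (rs i)             ≈⟨ +-identityʳ _ ⟨
      (rs i - r) * eval (quotient P r) (rs i) + 0#        ≈⟨ +-congˡ (roots (suc d) ℕ.≤-refl) ⟨
      (rs i - r) * eval (quotient P r) (rs i) + eval P r  ≈⟨ factor-theorem P r (rs i) ⟨
      eval P (rs i)                                       ≈⟨ roots i (ℕ.m≤n⇒m≤1+n i≤d) ⟩
      0#                                                  ∎)
      (λ rsᵢ-r≈0 → distinct i (suc d) (s≤s i≤d) ℕ.≤-refl (x∙y⁻¹≈ε⇒x≈y _ _ rsᵢ-r≈0))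

δ : ℕ → ℕ → ℕ → ℕ
δ i t k with k ℕ.≟ i
... | yes _ = t
... | no  _ = 0

δ-on : ∀ i t → δ i t i ≡ t
δ-on i t with i ℕ.≟ i
... | yes _   = ≡.refl
... | no  i≢i = ⊥-elim (i≢i ≡.refl)

δ-off : ∀ {i k} t → k ≢ i → δ i t k ≡ 0
δ-off {i} {k} t k≢i with k ℕ.≟ i
... | yes k≡i = ⊥-elim (k≢i k≡i)
... | no  _   = ≡.refl

module CharacteristicP {c ℓ} (F : Field c ℓ) (m : ℕ) (p-prime : Prime (suc (suc m)))
                       (char : FieldOps.HasCharacteristic F (suc (suc m))) where
  p : ℕ
  p = suc (suc m)

  open Field F
  open FieldOps F p
  open IntegerCoefficients commutativeRing
  open Polynomial F
  open import Algebra.Properties.Ring ring using (-0#≈0#; +-inverseʳ-unique; x≈y⇒x∙y⁻¹≈ε)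
  open import Algebra.Properties.Semiring.Mult semiring using (_×_; ×-congʳ; ×-homo-+; ×-assocˡ; ×-assoc-*)
  open import Algebra.Properties.Semiring.Exp semiring using (_^_; ^-congˡ)
  open import Algebra.Properties.CommutativeSemiring.Exp commutativeSemiring using (^-distrib-*)
  open import Relation.Binary.Reasoning.Setoid setoid

  ·≡× : ∀ k a → k · a ≡ k × a
  ·≡× zero    a = ≡.refl
  ·≡× (suc k) a = ≡.cong (a +_) (·≡× k a)

  pow≡^ : ∀ a k → pow a k ≡ a ^ k
  pow≡^ a zero    = ≡.refl
  pow≡^ a (suc k) = ≡.cong (a *_) (pow≡^ a k)

  p×1≈0 : p × 1# ≈ 0#
  p×1≈0 = ≡.subst (_≈ 0#) (·≡× p 1#) char

  ×-0# : ∀ k → k × 0# ≈ 0#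
  ×-0# zero    = refl
  ×-0# (suc k) = trans (+-identityˡ _) (×-0# k)

  ×1≈0-on-multiples : ∀ {a} → a × 1# ≈ 0# → ∀ q → (q ℕ.* a) × 1# ≈ 0#
  ×1≈0-on-multiples {a} a×1≈0 q = begin
    (q ℕ.* a) × 1#    ≈⟨ ×-assocˡ 1# q a ⟨
    q × (a × 1#)      ≈⟨ ×-congʳ q a×1≈0 ⟩
    q × 0#            ≈⟨ ×-0# q ⟩
    0#                ∎

  ¬Bézout-in-kernel : ∀ {a b} → a × 1# ≈ 0# → b × 1# ≈ 0# → ∀ x y → 1 ℕ.+ y ℕ.* a ≢ x ℕ.* b
  ¬Bézout-in-kernel {a} {b} a×1≈0 b×1≈0 x y eq = 0≉1 (begin
    0#                      ≈⟨ ×1≈0-on-multiples b×1≈0 x ⟨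
    (x ℕ.* b) × 1#          ≡⟨ ≡.cong (_× 1#) eq ⟨
    (1 ℕ.+ y ℕ.* a) × 1#    ≈⟨ ×-homo-+ 1# 1 (y ℕ.* a) ⟩
    1 × 1# + (y ℕ.* a) × 1# ≈⟨ +-cong (+-identityʳ 1#) (×1≈0-on-multiples a×1≈0 y) ⟩
    1# + 0#                 ≈⟨ +-identityʳ 1# ⟩
    1#                      ∎)

  ×1≉0-below-p : ∀ d → 0 < d → d < p → ¬ d × 1# ≈ 0#
  ×1≉0-below-p d@(suc _) _ d<p d×1≈0 with coprime-Bézout (prime⇒coprime p-prime d<p)
  ... | Bézout.+- x y eq = ¬Bézout-in-kernel d×1≈0 p×1≈0 x y eq
  ... | Bézout.-+ x y eq = ¬Bézout-in-kernel p×1≈0 d×1≈0 y x eq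

  binomial≈0 : ∀ k → 0 < k → k < p → (p C k) × 1# ≈ 0#
  binomial≈0 k 0<k k<p with prime∣pCk p-prime 0<k k<p
  ... | divides q pCk≡q*p = ≡.subst (λ n → n × 1# ≈ 0#) (≡.sym pCk≡q*p) (×1≈0-on-multiples p×1≈0 q)

  φ≈^p : ∀ a → φ a ≈ a ^ p
  φ≈^p a = reflexive (pow≡^ a p)

  φ-cong : ∀ {a b} → a ≈ b → φ a ≈ φ b
  φ-cong {a} {b} a≈b = trans (φ≈^p a) (trans (^-congˡ p a≈b) (sym (φ≈^p b)))

  φ-+ : ∀ a b → φ (a + b) ≈ φ a + φ b
  φ-+ a b = begin
    φ (a + b)      ≈⟨ φ≈^p (a + b) ⟩
    (a + b) ^ p    ≈⟨ ^-distrib-+-if-binomials-vanish commutativeSemiring (suc m) binomial≈0 a b ⟩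
    a ^ p + b ^ p  ≈⟨ +-cong (φ≈^p a) (φ≈^p b) ⟨
    φ a + φ b      ∎

  φ-* : ∀ a b → φ (a * b) ≈ φ a * φ b
  φ-* a b = begin
    φ (a * b)      ≈⟨ φ≈^p (a * b) ⟩
    (a * b) ^ p    ≈⟨ ^-distrib-* a b p ⟩
    a ^ p * b ^ p  ≈⟨ *-cong (φ≈^p a) (φ≈^p b) ⟨
    φ a * φ b      ∎

  φ-1# : φ 1# ≈ 1#
  φ-1# = trans (φ≈^p 1#) (1#^≈1# p)
    where
    1#^≈1# : ∀ k → 1# ^ k ≈ 1#
    1#^≈1# zero    = refl
    1#^≈1# (suc k) = trans (*-identityˡ _) (1#^≈1# k)

  φ-0# : φ 0# ≈ 0#
  φ-0# = zeroˡ _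

  φ-‿ : ∀ a → φ (- a) ≈ - φ a
  φ-‿ a = +-inverseʳ-unique (φ a) (φ (- a)) (begin
    φ a + φ (- a)  ≈⟨ φ-+ a (- a) ⟨
    φ (a - a)      ≈⟨ φ-cong (-‿inverseʳ a) ⟩
    φ 0#           ≈⟨ φ-0# ⟩
    0#             ∎)

  φ-℘ : ∀ a → φ (℘ a) ≈ ℘ (φ a)
  φ-℘ a = trans (φ-+ (φ a) (- a)) (+-congˡ (φ-‿ a))

  ℘-cong : ∀ {a b} → a ≈ b → ℘ a ≈ ℘ b
  ℘-cong a≈b = +-cong (φ-cong a≈b) (-‿cong a≈b)

  ℘-+ : ∀ a b → ℘ (a + b) ≈ ℘ a + ℘ b
  ℘-+ a b = trans (+-congʳ (φ-+ a b))
    (solve 4 (λ A B a b → (A :+ B) :- (a :+ b) := (A :- a) :+ (B :- b)) refl (φ a) (φ b) a b)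

  ℘-‿ : ∀ a → ℘ (- a) ≈ - ℘ a
  ℘-‿ a = trans (+-congʳ (φ-‿ a)) (solve 2 (λ A a → :- A :- :- a := :- (A :- a)) refl (φ a) a)

  ℘-* : ∀ a b → ℘ (a * b) ≈ φ a * ℘ b + ℘ a * b
  ℘-* a b = trans (+-congʳ (φ-* a b))
    (solve 4 (λ A B a b → A :* B :- a :* b := A :* (B :- b) :+ (A :- a) :* b) refl (φ a) (φ b) a b)

  ℘-0# : ℘ 0# ≈ 0#
  ℘-0# = trans (+-cong φ-0# -0#≈0#) (+-identityʳ 0#)

  ℘-× : ∀ k a → ℘ (k × a) ≈ k × ℘ a
  ℘-× zero    a = ℘-0#
  ℘-× (suc k) a = trans (℘-+ a (k × a)) (+-congˡ (℘-× k a))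

  ℘-Σ≤ : ∀ n f → ℘ (Σ≤ n f) ≈ Σ≤ n (λ k → ℘ (f k))
  ℘-Σ≤ zero    f = refl
  ℘-Σ≤ (suc n) f = trans (℘-+ _ _) (+-congʳ (℘-Σ≤ n f))

  φ-×1# : ∀ k → φ (k × 1#) ≈ k × 1#
  φ-×1# zero    = φ-0#
  φ-×1# (suc k) = trans (φ-+ 1# (k × 1#)) (+-cong φ-1# (φ-×1# k))

  ℘-×1# : ∀ k → ℘ (k × 1#) ≈ 0#
  ℘-×1# k = x≈y⇒x∙y⁻¹≈ε (φ-×1# k)

  ×1-injective-below-p : ∀ {i j} → i < j → j < p → ¬ i × 1# ≈ j × 1#
  ×1-injective-below-p {i} {j} i<j j<p i×1≈j×1 =
    ×1≉0-below-p (j ∸ i) (ℕ.m<n⇒0<n∸m i<j) (ℕ.≤-<-trans (ℕ.m∸n≤m j i) j<p) (begin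
      (j ∸ i) × 1#                         ≈⟨ solve 2 (λ a b → b := (a :+ b) :- a) refl (i × 1#) _ ⟩
      (i × 1# + (j ∸ i) × 1#) - i × 1#     ≈⟨ +-congʳ (×-homo-+ 1# i (j ∸ i)) ⟨
      (i ℕ.+ (j ∸ i)) × 1# - i × 1#        ≡⟨ ≡.cong (λ k → k × 1# - i × 1#) (ℕ.m+[n∸m]≡n (ℕ.<⇒≤ i<j)) ⟩
      j × 1# - i × 1#                      ≈⟨ x≈y⇒x∙y⁻¹≈ε (sym i×1≈j×1) ⟩
      0#                                   ∎)

  ℘-kernel : ∀ {y} → ℘ y ≈ 0# → ¬ (∀ k → k < p → ¬ y ≈ k × 1#)
  -- X ^ p - X has the p roots k · 1 (k < p), so it cannot have y as a further root.
  ℘-kernel {y} ℘y≈0 y∉𝔽ₚ = 0≉1 (sym (begin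
    1#                  ≡⟨ last-monomial m ⟨
    last ℘-polynomial   ≈⟨ last≈0-of-distinct-roots p ℘-polynomial candidates distinct roots ⟩
    0#                  ∎))
    where
    ℘-polynomial = 0# ∷ - 1# ∷ monomial m
    eval-℘-polynomial : ∀ x → eval ℘-polynomial x ≈ ℘ x
    eval-℘-polynomial x = begin
      0# + x * (- 1# + x * eval (monomial m) x)  ≈⟨ +-congˡ (*-congˡ (+-congˡ (*-congˡ (eval-monomial m x)))) ⟩
      0# + x * (- 1# + x * x ^ m)
        ≈⟨ solve 3 (λ x T o → con (ℤ.+ 0) :+ x :* (:- o :+ x :* T) := x :* (x :* T) :- x :* o) refl x (x ^ m) 1# ⟩
      x ^ p - x * 1#                             ≈⟨ +-cong (sym (φ≈^p x)) (-‿cong (*-identityʳ x)) ⟩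
      ℘ x                                        ∎
    candidates : ℕ → Carrier
    candidates zero    = y
    candidates (suc k) = k × 1#
    distinct : ∀ i j → i < j → j ≤ p → ¬ candidates i ≈ candidates j
    distinct zero    (suc k) _         k<p = y∉𝔽ₚ k k<p
    distinct (suc i) (suc j) (s≤s i<j) j<p = ×1-injective-below-p i<j j<p
    roots : ∀ i → i ≤ p → eval ℘-polynomial (candidates i) ≈ 0#
    roots zero    _ = trans (eval-℘-polynomial y) ℘y≈0
    roots (suc k) _ = trans (eval-℘-polynomial (k × 1#)) (℘-×1# k)

  φ^-cong : ∀ k {a b} → a ≈ b → φ^ k a ≈ φ^ k b
  φ^-cong zero    a≈b = a≈b
  φ^-cong (suc k) a≈b = φ-cong (φ^-cong k a≈b)

  φ^-* : ∀ k a b → φ^ k (a * b) ≈ φ^ k a * φ^ k b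
  φ^-* zero    a b = refl
  φ^-* (suc k) a b = trans (φ-cong (φ^-* k a b)) (φ-* _ _)

  φ^-1# : ∀ k → φ^ k 1# ≈ 1#
  φ^-1# zero    = refl
  φ^-1# (suc k) = trans (φ-cong (φ^-1# k)) φ-1#

  φ^-℘ : ∀ k a → φ^ k (℘ a) ≈ ℘ (φ^ k a)
  φ^-℘ zero    a = refl
  φ^-℘ (suc k) a = trans (φ-cong (φ^-℘ k a)) (φ-℘ _)

  Σ≤-cong : ∀ n {f g} → (∀ k → k ≤ n → f k ≈ g k) → Σ≤ n f ≈ Σ≤ n g
  Σ≤-cong zero    f≈g = f≈g 0 z≤n
  Σ≤-cong (suc n) f≈g = +-cong (Σ≤-cong n (λ k k≤n → f≈g k (ℕ.m≤n⇒m≤1+n k≤n))) (f≈g (suc n) ℕ.≤-refl)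

  Σ≤-+ : ∀ n f g → Σ≤ n (λ k → f k + g k) ≈ Σ≤ n f + Σ≤ n g
  Σ≤-+ zero    f g = refl
  Σ≤-+ (suc n) f g = trans (+-congʳ (Σ≤-+ n f g))
    (solve 4 (λ a b c d → (a :+ b) :+ (c :+ d) := (a :+ c) :+ (b :+ d)) refl _ _ _ _)

  Σ≤-*ʳ : ∀ n f c → Σ≤ n f * c ≈ Σ≤ n (λ k → f k * c)
  Σ≤-*ʳ zero    f c = refl
  Σ≤-*ʳ (suc n) f c = trans (distribʳ c _ _) (+-congʳ (Σ≤-*ʳ n f c))

  Σ≤-zero : ∀ n f → (∀ k → k ≤ n → f k ≈ 0#) → Σ≤ n f ≈ 0#
  Σ≤-zero zero    f f≈0 = f≈0 0 z≤n
  Σ≤-zero (suc n) f f≈0 =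
    trans (+-cong (Σ≤-zero n f (λ k k≤n → f≈0 k (ℕ.m≤n⇒m≤1+n k≤n))) (f≈0 (suc n) ℕ.≤-refl)) (+-identityʳ 0#)

  δ×-on : ∀ i t a → δ i t i × a ≈ t × a
  δ×-on i t a = reflexive (≡.cong (_× a) (δ-on i t))

  δ×-off : ∀ {i k} t a → k ≢ i → δ i t k × a ≈ 0#
  δ×-off t a k≢i = reflexive (≡.cong (_× a) (δ-off t k≢i))

  Σ≤-δ : ∀ n {i} t (w : ℕ → Carrier) → i ≤ n → Σ≤ n (λ k → δ i t k × w k) ≈ t × w i
  Σ≤-δ zero {zero} t w _ = δ×-on 0 t (w 0)
  Σ≤-δ (suc n) {i} t w i≤1+n with ℕ.m≤n⇒m<n∨m≡n i≤1+n
  ... | inj₁ (s≤s i≤n) =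
    trans (+-cong (Σ≤-δ n t w i≤n) (δ×-off t _ (ℕ.>⇒≢ (s≤s i≤n)))) (+-identityʳ _)
  ... | inj₂ ≡.refl    =
    trans (+-cong (Σ≤-zero n _ (λ k k≤n → δ×-off t _ (ℕ.<⇒≢ (s≤s k≤n)))) (δ×-on i t _)) (+-identityˡ _)

  module Independence (n : ℕ) where

    IndependentFrom : ℕ → (ℕ → Carrier) → Set ℓ
    IndependentFrom i w = ∀ (cf : ℕ → ℕ) → (∀ k → k ≤ n → cf k < p) → (∀ k → k < i → cf k ≡ 0) →
                          Σ≤ n (λ k → cf k × w k) ≈ 0# → ∀ k → k ≤ n → cf k ≡ 0

    LinIndepFp⇒IndependentFrom0 : ∀ {w} → LinIndepFp n w → IndependentFrom 0 w
    LinIndepFp⇒IndependentFrom0 {w} indep cf cf<p _ Σ≈0 =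
      indep cf cf<p (trans (Σ≤-cong n (λ k _ → reflexive (·≡× (cf k) (w k)))) Σ≈0)

    combination≉nonzero-scalar : ∀ {i w} → IndependentFrom i w → w i ≈ 1# → i ≤ n →
      ∀ (cf : ℕ → ℕ) → (∀ k → k ≤ n → cf k < p) → (∀ k → k ≤ i → cf k ≡ 0) →
      ∀ c → 0 < c → c < p → ¬ Σ≤ n (λ k → cf k × w k) ≈ c × 1#
    combination≉nonzero-scalar {i} {w} indep wᵢ≈1 i≤n cf cf<p cf≡0 c 0<c c<p Σ≈c =
      ℕ.m<n⇒n≢0 (ℕ.m<n⇒0<n∸m c<p) p∸c≡0
      where
      -- Since w i ≈ 1, adding (p - c) · w i turns the combination into p · 1 ≈ 0.
      t = p ∸ c
      cf′ : ℕ → ℕ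
      cf′ k = cf k ℕ.+ δ i t k
      cf′<p : ∀ k → k ≤ n → cf′ k < p
      cf′<p k k≤n with k ℕ.≟ i
      ... | yes ≡.refl = ≡.subst (λ a → a ℕ.+ t < p) (≡.sym (cf≡0 k ℕ.≤-refl)) (ℕ.∸-monoʳ-< 0<c (ℕ.<⇒≤ c<p))
      ... | no  _      = ≡.subst (_< p) (≡.sym (ℕ.+-identityʳ (cf k))) (cf<p k k≤n)
      cf′≡0 : ∀ k → k < i → cf′ k ≡ 0
      cf′≡0 k k<i = ≡.cong₂ ℕ._+_ (cf≡0 k (ℕ.<⇒≤ k<i)) (δ-off t (ℕ.<⇒≢ k<i))
      Σ′≈0 : Σ≤ n (λ k → cf′ k × w k) ≈ 0#
      Σ′≈0 = begin
        Σ≤ n (λ k → cf′ k × w k)                                  ≈⟨ Σ≤-cong n (λ k _ → ×-homo-+ (w k) (cf k) (δ i t k)) ⟩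
        Σ≤ n (λ k → cf k × w k + δ i t k × w k)                   ≈⟨ Σ≤-+ n _ _ ⟩
        Σ≤ n (λ k → cf k × w k) + Σ≤ n (λ k → δ i t k × w k)      ≈⟨ +-cong Σ≈c (Σ≤-δ n t w i≤n) ⟩
        c × 1# + t × w i                                          ≈⟨ +-congˡ (×-congʳ t wᵢ≈1) ⟩
        c × 1# + t × 1#                                           ≈⟨ ×-homo-+ 1# c t ⟨
        (c ℕ.+ t) × 1#                                            ≡⟨ ≡.cong (_× 1#) (ℕ.m+[n∸m]≡n (ℕ.<⇒≤ c<p)) ⟩
        p × 1#                                                    ≈⟨ p×1≈0 ⟩
        0#                                                        ∎
      p∸c≡0 : t ≡ 0
      p∸c≡0 = ≡.trans (≡.sym (δ-on i t))
                (≡.trans (≡.cong (ℕ._+ δ i t i) (≡.sym (cf≡0 i ℕ.≤-refl))) (indep cf′ cf′<p cf′≡0 Σ′≈0 i i≤n))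

    ℘-combination≈0⇒trivial : ∀ {i w} → IndependentFrom i w → w i ≈ 1# → i ≤ n →
      ∀ (cf : ℕ → ℕ) → (∀ k → k ≤ n → cf k < p) → (∀ k → k ≤ i → cf k ≡ 0) →
      ℘ (Σ≤ n (λ k → cf k × w k)) ≈ 0# → ∀ k → k ≤ n → cf k ≡ 0
    ℘-combination≈0⇒trivial {i} {w} indep wᵢ≈1 i≤n cf cf<p cf≡0 ℘Σ≈0 k k≤n with cf k ℕ.≟ 0
    ... | yes cfₖ≡0 = cfₖ≡0
    ... | no  cfₖ≢0 = ⊥-elim (℘-kernel ℘Σ≈0 Σ∉𝔽ₚ)
      where
      Σ∉𝔽ₚ : ∀ c → c < p → ¬ Σ≤ n (λ k → cf k × w k) ≈ c × 1#
      Σ∉𝔽ₚ zero    _   Σ≈0 = cfₖ≢0 (indep cf cf<p (λ k k<i → cf≡0 k (ℕ.<⇒≤ k<i)) Σ≈0 k k≤n)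
      Σ∉𝔽ₚ (suc c) c<p     = combination≉nonzero-scalar indep wᵢ≈1 i≤n cf cf<p cf≡0 (suc c) (s≤s z≤n) c<p

    ℘≉0-next : ∀ {i w} → IndependentFrom i w → w i ≈ 1# → suc i ≤ n → ¬ ℘ (w (suc i)) ≈ 0#
    ℘≉0-next {i} {w} indep wᵢ≈1 i<n ℘w≈0 =
      ℕ.1+n≢0 (≡.trans (≡.sym (δ-on (suc i) 1))
                       (℘-combination≈0⇒trivial indep wᵢ≈1 (ℕ.<⇒≤ i<n) (δ (suc i) 1) δ<p δ≡0 ℘Σ≈0 (suc i) i<n))
      where
      δ<p : ∀ k → k ≤ n → δ (suc i) 1 k < p
      δ<p k _ with k ℕ.≟ suc i
      ... | yes _ = s≤s (s≤s z≤n)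
      ... | no  _ = s≤s z≤n
      δ≡0 : ∀ k → k ≤ i → δ (suc i) 1 k ≡ 0
      δ≡0 k k≤i = δ-off 1 (ℕ.<⇒≢ (s≤s k≤i))
      ℘Σ≈0 : ℘ (Σ≤ n (λ k → δ (suc i) 1 k × w k)) ≈ 0#
      ℘Σ≈0 = trans (℘-cong (trans (Σ≤-δ n 1 w i<n) (+-identityʳ _))) ℘w≈0

    ℘-ratio : (ℕ → Carrier) → ℕ → ℕ → Carrier
    ℘-ratio w j k = ℘ (w k) * ℘ (w j) ⁻¹

    ℘-ratio-* : ∀ {w j} → ¬ ℘ (w j) ≈ 0# → ∀ k → ℘-ratio w j k * ℘ (w j) ≈ ℘ (w k)
    ℘-ratio-* {w} {j} ℘wⱼ≉0 k = begin
      (℘ (w k) * D ⁻¹) * D   ≈⟨ *-assoc _ _ _ ⟩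
      ℘ (w k) * (D ⁻¹ * D)   ≈⟨ *-congˡ (*-comm _ _) ⟩
      ℘ (w k) * (D * D ⁻¹)   ≈⟨ *-congˡ (⁻¹-inverse D ℘wⱼ≉0) ⟩
      ℘ (w k) * 1#           ≈⟨ *-identityʳ _ ⟩
      ℘ (w k)                ∎
      where D = ℘ (w j)

    IndependentFrom-℘-ratio : ∀ {i w} → IndependentFrom i w → w i ≈ 1# → suc i ≤ n →
                              IndependentFrom (suc i) (℘-ratio w (suc i))
    IndependentFrom-℘-ratio {i} {w} indep wᵢ≈1 i<n cf cf<p cf≡0 Σ≈0 =
      ℘-combination≈0⇒trivial indep wᵢ≈1 (ℕ.<⇒≤ i<n) cf cf<p (λ k k≤i → cf≡0 k (s≤s k≤i)) (begin
        ℘ (Σ≤ n (λ k → cf k × w k))                       ≈⟨ ℘-Σ≤ n _ ⟩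
        Σ≤ n (λ k → ℘ (cf k × w k))                       ≈⟨ Σ≤-cong n (λ k _ → ℘-× (cf k) (w k)) ⟩
        Σ≤ n (λ k → cf k × ℘ (w k))                       ≈⟨ Σ≤-cong n (λ k _ → ×-congʳ (cf k) (℘-ratio-* {w} ℘≉0 k)) ⟨
        Σ≤ n (λ k → cf k × (℘-ratio w (suc i) k * D))     ≈⟨ Σ≤-cong n (λ k _ → ×-assoc-* (cf k) _ D) ⟨
        Σ≤ n (λ k → cf k × ℘-ratio w (suc i) k * D)       ≈⟨ Σ≤-*ʳ n _ D ⟨
        Σ≤ n (λ k → cf k × ℘-ratio w (suc i) k) * D       ≈⟨ *-congʳ Σ≈0 ⟩
        0# * D                                            ≈⟨ zeroˡ D ⟩
        0#                                                ∎)
      where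
      D = ℘ (w (suc i))
      ℘≉0 = ℘≉0-next indep wᵢ≈1 i<n

module FieldHomomorphism {c ℓ c' ℓ'} (K : Field c ℓ) (L : Field c' ℓ')
                         (ι : Field.Carrier K → Field.Carrier L) (hom : IsFieldHom K L ι) (p : ℕ) where
  private
    module K where
      open Field K public
      open FieldOps K p public
  open Field L
  open FieldOps L p
  open RingMorphisms.IsRingHomomorphism hom
  open import Relation.Binary.Reasoning.Setoid setoid

  ι-pow : ∀ a k → ι (K.pow a k) ≈ pow (ι a) k
  ι-pow a zero    = 1#-homo
  ι-pow a (suc k) = trans (*-homo _ _) (*-congˡ (ι-pow a k))

  ι-φ : ∀ a → ι (K.φ a) ≈ φ (ι a)
  ι-φ a = ι-pow a p

  ι-℘ : ∀ a → ι (K.℘ a) ≈ ℘ (ι a)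
  ι-℘ a = trans (+-homo _ _) (+-cong (ι-φ a) (-‿homo a))

  ι-· : ∀ k a → ι (k K.· a) ≈ k · ι a
  ι-· zero    a = 0#-homo
  ι-· (suc k) a = trans (+-homo _ _) (+-congˡ (ι-· k a))

  HasCharacteristic-transfer : K.HasCharacteristic → HasCharacteristic
  HasCharacteristic-transfer charK = begin
    p · 1#         ≈⟨ ·-cong p 1#-homo ⟨
    p · ι K.1#     ≈⟨ ι-· p K.1# ⟨
    ι (p K.· K.1#) ≈⟨ ⟦⟧-cong charK ⟩
    ι K.0#         ≈⟨ 0#-homo ⟩
    0#             ∎
    where
    ·-cong : ∀ k {a b} → a ≈ b → k · a ≈ k · b
    ·-cong zero    _   = refl
    ·-cong (suc k) a≈b = +-cong a≈b (·-cong k a≈b)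

module NearOneDimensional {c ℓ c' ℓ'} (m : ℕ) (p-prime : Prime (suc (suc m)))
  (K : Field c ℓ) (L : Field c' ℓ') (charK : FieldOps.HasCharacteristic K (suc (suc m)))
  (ι : Field.Carrier K → Field.Carrier L) (hom : IsFieldHom K L ι)
  (n : ℕ) (x : ℕ → Field.Carrier L) (Ω : ℕ → Field.Carrier K)
  (β : Field.Carrier K) (ε : ℕ → Field.Carrier K)
  (Ω₀≈1 : Field._≈_ K (Ω 0) (Field.1# K))
  (indep : FieldOps.LinIndepFp K (suc (suc m)) n Ω)
  (ε₀≈0 : Field._≈_ K (ε 0) (Field.0# K))
  (℘x : ∀ i → i ≤ n → Field._≈_ L (FieldOps.℘ L (suc (suc m)) (x i))
          (ι (Field._+_ K (Field._*_ K (FieldOps.φ^ K (suc (suc m)) n (Ω i)) β) (ε i)))) where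

  private
    p = suc (suc m)
    module K where
      open Field K public
      open FieldOps K p public
      open CharacteristicP K m p-prime charK public
      open Independence n public
      open IntegerCoefficients commutativeRing public
    open FieldHomomorphism K L ι hom p
    module ι = RingMorphisms.IsRingHomomorphism hom

  open Construction K L ι p n x Ω β ε
  open import Data.Product using (_×_)

  Ωs-independent : ∀ i → i ≤ n → K.IndependentFrom i (Ωs i) × Ωs i i K.≈ K.1#
  Ωs-independent zero    _   = K.LinIndepFp⇒IndependentFrom0 indep , Ω₀≈1
  Ωs-independent (suc i) i<n = K.IndependentFrom-℘-ratio indepᵢ Ωᵢᵢ≈1 i<n ,
                               K.⁻¹-inverse _ (K.℘≉0-next indepᵢ Ωᵢᵢ≈1 i<n)
    where
    indepᵢ = proj₁ (Ωs-independent i (ℕ.<⇒≤ i<n))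
    Ωᵢᵢ≈1  = proj₂ (Ωs-independent i (ℕ.<⇒≤ i<n))

  Ωs-diagonal : ∀ i → i ≤ n → Ωs i i K.≈ K.1#
  Ωs-diagonal i i≤n = proj₂ (Ωs-independent i i≤n)

  ℘Ωs≉0 : ∀ i → suc i ≤ n → ¬ K.℘ (Ωs i (suc i)) K.≈ K.0#
  ℘Ωs≉0 i i<n = K.℘≉0-next (proj₁ (Ωs-independent i (ℕ.<⇒≤ i<n))) (Ωs-diagonal i (ℕ.<⇒≤ i<n)) i<n

  E-diagonal : ∀ i → E i i K.≈ K.0#
  E-diagonal zero = ε₀≈0
  E-diagonal (suc i) with suc i ℕ.≟ suc i
  ... | yes _   = K.refl
  ... | no  i≢i = ⊥-elim (i≢i ≡.refl)

  E-recurrence : ∀ i j → suc i ≤ n →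
    K.φ^ (n ∸ suc i) (Ωs (suc i) j) K.* E i (suc i) K.+ E (suc i) j K.≈ E i j
  E-recurrence i j i<n with j ℕ.≟ suc i
  ... | yes ≡.refl = K.trans (K.+-identityʳ _) (K.trans (K.*-congʳ Ω′≈1) (K.*-identityˡ _))
    where Ω′≈1 = K.trans (K.φ^-cong (n ∸ suc i) (Ωs-diagonal (suc i) i<n)) (K.φ^-1# (n ∸ suc i))
  ... | no  _ = K.solve 2 (λ a b → a K.:+ (b K.:- a) K.:= b) K.refl _ (E i j)

  Ωs-recurrence : ∀ i j → suc i ≤ n →
    K.φ^ (n ∸ suc i) (Ωs (suc i) j) K.* K.φ^ (n ∸ suc i) (K.℘ (Ωs i (suc i))) K.≈ K.℘ (K.φ^ (n ∸ suc i) (Ωs i j))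
  Ωs-recurrence i j i<n = K.trans (K.sym (K.φ^-* M _ _))
                         (K.trans (K.φ^-cong M (K.℘-ratio-* {Ωs i} (℘Ωs≉0 i i<n) j)) (K.φ^-℘ M _))
    where M = n ∸ suc i

  private
    module L where
      open Field L public
      open FieldOps L p public
      open CharacteristicP L m p-prime (HasCharacteristic-transfer charK) public
      open IntegerCoefficients commutativeRing public

  open Field L
  open FieldOps L p using (℘)
  open import Relation.Binary.Reasoning.Setoid setoid

  ι-B-recurrence : ∀ i j → suc i ≤ n →
    ι (K.φ^ (n ∸ suc i) (Ωs (suc i) j)) * B (suc i) + ι (E (suc i) j)
      ≈ ι (E i j) - ι (K.℘ (K.φ^ (n ∸ suc i) (Ωs i j))) * X i i
  ι-B-recurrence i j i<n = begin
    ι ω′ * (- (ι D * Y) + ι (E i (suc i))) + ι (E (suc i) j)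
      ≈⟨ L.solve 5 (λ c d y e f → c L.:* (L.:- (d L.:* y) L.:+ e) L.:+ f
                                  L.:= (c L.:* e L.:+ f) L.:- (c L.:* d) L.:* y) refl (ι ω′) (ι D) Y _ _ ⟩
    (ι ω′ * ι (E i (suc i)) + ι (E (suc i) j)) - (ι ω′ * ι D) * Y
      ≈⟨ +-cong (trans (+-congʳ (sym (ι.*-homo _ _))) (trans (sym (ι.+-homo _ _)) (ι.⟦⟧-cong (E-recurrence i j i<n))))
                (-‿cong (*-congʳ (trans (sym (ι.*-homo _ _)) (ι.⟦⟧-cong (Ωs-recurrence i j i<n))))) ⟩
    ι (E i j) - ι (K.℘ (K.φ^ M (Ωs i j))) * Y
      ∎
    where
    M  = n ∸ suc i
    ω′ = K.φ^ M (Ωs (suc i) j)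
    D  = K.φ^ M (K.℘ (Ωs i (suc i)))
    Y  = X i i

  ℘X-diagonal : ∀ i → i ≤ n → ℘ (X i i) ≈ ι (K.φ^ (n ∸ i) (Ωs i i)) * B i + ι (E i i) → ℘ (X i i) ≈ B i
  ℘X-diagonal i i≤n ℘Xᵢᵢ = begin
    ℘ (X i i)                                        ≈⟨ ℘Xᵢᵢ ⟩
    ι (K.φ^ (n ∸ i) (Ωs i i)) * B i + ι (E i i)      ≈⟨ +-cong (*-congʳ (ι.⟦⟧-cong φ^Ωᵢᵢ≈1)) (ι.⟦⟧-cong (E-diagonal i)) ⟩
    ι K.1# * B i + ι K.0#                            ≈⟨ +-cong (*-congʳ ι.1#-homo) ι.0#-homo ⟩
    1# * B i + 0#                                    ≈⟨ trans (+-identityʳ _) (*-identityˡ _) ⟩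
    B i                                              ∎
    where φ^Ωᵢᵢ≈1 = K.trans (K.φ^-cong (n ∸ i) (Ωs-diagonal i i≤n)) (K.φ^-1# (n ∸ i))

  ℘-X : ∀ i j → i ≤ n → j ≤ n → ℘ (X i j) ≈ ι (K.φ^ (n ∸ i) (Ωs i j)) * B i + ι (E i j)
  ℘-X zero    j _   j≤n = trans (℘x j j≤n) (trans (ι.+-homo _ _) (+-congʳ (ι.*-homo _ _)))
  ℘-X (suc i) j i<n j≤n = begin
    ℘ (X i j - ι ω * Y)                                                  ≈⟨ L.℘-+ _ _ ⟩
    ℘ (X i j) + ℘ (- (ι ω * Y))                                          ≈⟨ +-cong ℘Xᵢⱼ (trans (L.℘-‿ _) (-‿cong ℘[ωY])) ⟩
    (ι (K.φ ω) * B i + ι (E i j)) - (ι (K.φ ω) * B i + ι (K.℘ ω) * Y)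
      ≈⟨ L.solve 5 (λ A b e w y → (A L.:* b L.:+ e) L.:- (A L.:* b L.:+ w L.:* y) L.:= e L.:- w L.:* y) refl _ _ _ _ _ ⟩
    ι (E i j) - ι (K.℘ ω) * Y                                            ≈⟨ ι-B-recurrence i j i<n ⟨
    ι (K.φ^ (n ∸ suc i) (Ωs (suc i) j)) * B (suc i) + ι (E (suc i) j)    ∎
    where
    i≤n = ℕ.<⇒≤ i<n
    ω   = K.φ^ (n ∸ suc i) (Ωs i j)
    Y   = X i i
    ℘Xᵢⱼ : ℘ (X i j) ≈ ι (K.φ ω) * B i + ι (E i j)
    ℘Xᵢⱼ = ≡.subst (λ k → ℘ (X i j) ≈ ι (K.φ^ k (Ωs i j)) * B i + ι (E i j)) (ℕ.+-∸-assoc 1 i<n) (℘-X i j i≤n j≤n)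
    ℘[ωY] : ℘ (ι ω * Y) ≈ ι (K.φ ω) * B i + ι (K.℘ ω) * Y
    ℘[ωY] = trans (L.℘-* (ι ω) Y)
                  (+-cong (*-cong (sym (ι-φ ω)) (℘X-diagonal i i≤n (℘-X i i i≤n i≤n))) (*-congʳ (sym (ι-℘ ω))))

lemma4p2 : ∀ {c ℓ c' ℓ'} (p : ℕ) → Prime p →
  (K : Field c ℓ) (L : Field c' ℓ') →
  FieldOps.HasCharacteristic K p →
  (ι : Field.Carrier K → Field.Carrier L) → IsFieldHom K L ι →
  (n : ℕ) (x : ℕ → Field.Carrier L) (Ω : ℕ → Field.Carrier K)
  (β : Field.Carrier K) (ε : ℕ → Field.Carrier K) →
  Field._≈_ K (Ω 0) (Field.1# K) →
  FieldOps.LinIndepFp K p n Ω →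
  Field._≈_ K (ε 0) (Field.0# K) →
  (∀ i → i ≤ n →
    Field._≈_ L (FieldOps.℘ L p (x i))
      (ι (Field._+_ K (Field._*_ K (FieldOps.φ^ K p n (Ω i)) β) (ε i)))) →
  ∀ i j → i ≤ j → j ≤ n →
    Field._≈_ L (FieldOps.℘ L p (Construction.X K L ι p n x Ω β ε i j))
      (Field._+_ L
        (Field._*_ L
          (ι (FieldOps.φ^ K p (n ∸ i) (Construction.Ωs K L ι p n x Ω β ε i j)))
          (Construction.B K L ι p n x Ω β ε i))
        (ι (Construction.E K L ι p n x Ω β ε i j)))
lemma4p2 zero ()
lemma4p2 (suc zero) ()
lemma4p2 (suc (suc m)) p-prime K L charK ι hom n x Ω β ε Ω₀≈1 indep ε₀≈0 ℘x i j i≤j j≤n =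
  NearOneDimensional.℘-X m p-prime K L charK ι hom n x Ω β ε Ω₀≈1 indep ε₀≈0 ℘x i j (ℕ.≤-trans i≤j j≤n) j≤n
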